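{- Let $G$ be a finite simple connected graph. For every integer $r\ge1$, \[w_{2r}(G) \le \left(\sum_{v\in V(G)} w_r(v)\sqrt{\frac{c(v)-1}{c(v)}}\right)^2.\]
   Context: For a vertex $v$, $w_r(v)$ is the number of walks with $r$ vertices (length $r-1$) in $G$ starting at $v$, and $w_r(G)=\sum_{v}w_r(v)$ is the total number of such walks. $c(v)$ is the order of the largest clique of $G$ containing $v$. -}

module Defs where

open import Data.Nat using (ℕ; zero; suc; _≤_)
import Data.Nat as ℕ
open import Data.Bool using (Bool; true; false; if_then_else_)
open import Data.Fin using (Fin; zero; suc)
open import Data.Fin.Subset using (Subset; _∈_; ∣_∣)
open import Data.Integer using (+_)
open import Data.Rational.Unnormalised using (ℚᵘ; mkℚᵘ; 0ℚᵘ)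
import Data.Rational.Unnormalised as Q
open import Data.Product using (Σ; _×_)
open import Relation.Binary.PropositionalEquality using (_≡_; _≢_)

record SimpleGraph (n : ℕ) : Set where
  field
    Adj    : Fin n → Fin n → Bool
    sym    : ∀ i j → Adj i j ≡ Adj j i
    irrefl : ∀ i → Adj i i ≡ false
open SimpleGraph public

sumFin : (n : ℕ) → (Fin n → ℕ) → ℕ
sumFin zero    f = 0
sumFin (suc n) f = f zero ℕ.+ sumFin n (λ i → f (suc i))

sumFinℚ : (n : ℕ) → (Fin n → ℚᵘ) → ℚᵘ
sumFinℚ zero    f = 0ℚᵘ
sumFinℚ (suc n) f = f zero Q.+ sumFinℚ n (λ i → f (suc i))

-- w_r(v): number of walks with r vertices starting at v (w_0 := 0, unused)
walks : {n : ℕ} → SimpleGraph n → ℕ → Fin n → ℕ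
walks G zero          v = 0
walks G (suc zero)    v = 1
walks {n} G (suc (suc r)) v =
  sumFin n (λ u → if Adj G v u then walks G (suc r) u else 0)

totalWalks : {n : ℕ} → SimpleGraph n → ℕ → ℕ
totalWalks {n} G r = sumFin n (walks G r)

data Reach {n : ℕ} (G : SimpleGraph n) : Fin n → Fin n → Set where
  here : ∀ {u} → Reach G u u
  step : ∀ {u w v} → Adj G u w ≡ true → Reach G w v → Reach G u v

Connected : {n : ℕ} → SimpleGraph n → Set
Connected {n} G = ∀ (u v : Fin n) → Reach G u v

IsClique : {n : ℕ} → SimpleGraph n → Subset n → Set
IsClique G S = ∀ i j → i ∈ S → j ∈ S → i ≢ j → Adj G i j ≡ true

IsMaxCliqueOrderAt : {n : ℕ} → SimpleGraph n → Fin n → ℕ → Set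
IsMaxCliqueOrderAt {n} G v k =
  Σ (Subset n) (λ S → IsClique G S × v ∈ S × ∣ S ∣ ≡ k)
  × (∀ (S : Subset n) → IsClique G S → v ∈ S → ∣ S ∣ ≤ k)

toℚ : ℕ → ℚᵘ
toℚ m = mkℚᵘ (+ m) 0

-- the rational (c-1)/c  (mkℚᵘ p d denotes p / (d+1)); c ≥ 1 in our use
cRatio : ℕ → ℚᵘ
cRatio c = mkℚᵘ (+ (c ℕ.∸ 1)) (c ℕ.∸ 1)

{-# OPTIONS --safe #-}
module Submission where

-- Since w_{r+1} = A w_r for the adjacency matrix A, w_{2r}(G) = ⟨w_r, A w_r⟩, so it suffices to show
-- ⟨x, A x⟩ ≤ (Σ_v x_v t_v)² for every nonnegative vector x (a weighted Motzkin–Straus inequality).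
-- This goes by induction on the support of x.  If the support is a clique of order K, then
-- ⟨x, A x⟩ = s² - Σ_v x_v² ≤ (1 - 1/K) s² with s = Σ_v x_v by Cauchy–Schwarz, while K ≤ c(v) gives
-- t_u t_v ≥ (K-1)/K on the support, hence (Σ_v x_v t_v)² ≥ (1 - 1/K) s².  Otherwise the support contains
-- non-adjacent u and v.  Moving weight between them along t_v e_u - t_u e_v keeps Σ_v x_v t_v fixed and
-- changes ⟨x, A x⟩ linearly, so in one of the two directions it does not decrease until x_u or x_v
-- vanishes.  A vertex with t_u = 0 has c(u) ≤ 1, so it is isolated and can simply be dropped.

open import Defs
open import Data.Nat using (ℕ; _*_)
open import Data.Fin using (Fin)
open import Data.Rational.Unnormalised using (ℚᵘ; 0ℚᵘ; _≤_)
import Data.Rational.Unnormalised as Q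
import Data.Nat as N

open import Algebra.Bundles using (CommutativeRing)
open import Data.Bool using (true; false; if_then_else_)
open import Data.Bool.Properties using () renaming (_≟_ to _≟ᵇ_)
open import Data.Fin using (zero; suc)
open import Data.Fin.Properties using (_≟_; any?)
open import Data.Fin.Subset using (Subset; inside; outside; _∈_; _∉_; _⊂_; ∣_∣; ⁅_⁆; _∪_)
open import Data.Fin.Subset.Properties
  using (_∈?_; x∈p∪q⁺; x∈p∪q⁻; q⊆p∪q; x∈⁅x⁆; x∈⁅y⁆⇒x≡y; x≢y⇒x∉⁅y⁆; ∣⁅x⁆∣≡1; p⊂q⇒∣p∣<∣q∣)
import Data.Integer as ℤ
import Data.Integer.Properties as ℤP
open import Data.Integer.Tactic.RingSolver using (solve-∀)
open import Data.Nat using (zero; suc)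
open import Data.Nat.Induction using (<-wellFounded)
import Data.Nat.Properties as NP
open import Data.Product using (_,_; _×_; ∃₂; proj₁; proj₂; uncurry)
open import Data.Rational.Unnormalised using (1ℚᵘ; _≃_; _≄_; _<_; _+_; _-_; -_) renaming (_*_ to _·_)
open import Data.Rational.Unnormalised.Properties
  using (≃-refl; ≃-sym; ≃-trans; ≃-reflexive; _≃?_; +-cong; +-congʳ; *-cong; *-congˡ; *-congʳ;
         +-identityˡ; +-identityʳ; *-identityˡ; *-zeroˡ; *-zeroʳ; *-comm; *-distribˡ-+; *-distribʳ-+;
         +-*-commutativeRing; module ≃-Reasoning)
import Data.Rational.Unnormalised.Properties as ℚP
open import Data.Rational.Unnormalised.Solver using (module +-*-Solver)
open import Data.Sum using (_⊎_; inj₁; inj₂)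
import Data.Sum as Sum
open import Data.Vec using (_∷_; []; lookup; tabulate)
open import Data.Vec.Functional using (Vector)
open import Data.Vec.Properties using (lookup∘tabulate; []=⇒lookup; lookup⇒[]=)
open import Induction.WellFounded using (module All)
import Relation.Binary.Construct.On as On
open import Relation.Binary.Definitions using (tri<; tri≈; tri>)
open import Relation.Binary.PropositionalEquality using (_≡_; _≢_; ≢-sym; refl; cong; cong₂)
import Relation.Binary.PropositionalEquality as ≡
open import Relation.Nullary using (contradiction; yes; no)
open import Relation.Nullary.Decidable using (does; ¬?; _×-dec_; dec-true; dec-false; decidable-stable)

open +-*-Solver using (solve; _:=_; _:+_; _:*_; _:-_; :-_; con)
open import Algebra.Properties.Semiring.Sum (CommutativeRing.semiring +-*-commutativeRing)
  using (sum; sum-cong-≋; sum-replicate-zero; ∑-distrib-+; ∑-comm; *-distribˡ-sum; *-distribʳ-sum)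

ℚⁿ : ℕ → Set
ℚⁿ = Vector ℚᵘ

nonNeg-· : ∀ {p q} → 0ℚᵘ ≤ p → 0ℚᵘ ≤ q → 0ℚᵘ ≤ p · q
nonNeg-· {p} {q} 0≤p 0≤q =
  ℚP.nonNegative⁻¹ _ {{ℚP.nonNeg*nonNeg⇒nonNeg p {{Q.nonNegative 0≤p}} q {{Q.nonNegative 0≤q}}}}

nonNeg-+ : ∀ {p q} → 0ℚᵘ ≤ p → 0ℚᵘ ≤ q → 0ℚᵘ ≤ p + q
nonNeg-+ {p} {q} 0≤p 0≤q =
  ℚP.nonNegative⁻¹ _ {{ℚP.nonNeg+nonNeg⇒nonNeg p {{Q.nonNegative 0≤p}} q {{Q.nonNegative 0≤q}}}}

p≤p+q : ∀ p {q} → 0ℚᵘ ≤ q → p ≤ p + q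
p≤p+q p {q} 0≤q = ℚP.p≤p+q p q {{Q.nonNegative 0≤q}}

·-monoʳ-≤ : ∀ {k p q} → 0ℚᵘ ≤ k → p ≤ q → k · p ≤ k · q
·-monoʳ-≤ {k} 0≤k = ℚP.*-monoʳ-≤-nonNeg k {{Q.nonNegative 0≤k}}

·-cancelˡ-≤ : ∀ {k p q} → 0ℚᵘ < k → k · p ≤ k · q → p ≤ q
·-cancelˡ-≤ {k} 0<k = ℚP.*-cancelˡ-≤-pos k {{Q.positive 0<k}}

+-cancelʳ-≤ : ∀ {a b} c → a + c ≤ b + c → a ≤ b
+-cancelʳ-≤ {a} {b} c a+c≤b+c = ℚP.≤-respˡ-≃ (cancel a) (ℚP.≤-respʳ-≃ (cancel b) (ℚP.+-monoˡ-≤ (- c) a+c≤b+c))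
  where
  cancel : ∀ p → p + c + - c ≃ p
  cancel p = solve 2 (λ p c → p :+ c :+ :- c := p) ≃-refl p c

square-nonNeg : ∀ p → 0ℚᵘ ≤ p · p
square-nonNeg p with ℚP.≤-total 0ℚᵘ p
... | inj₁ 0≤p = nonNeg-· 0≤p 0≤p
... | inj₂ p≤0 = ℚP.≤-respʳ-≃ (neg-square p) (nonNeg-· 0≤-p 0≤-p)
  where
  0≤-p : 0ℚᵘ ≤ - p
  0≤-p = ℚP.neg-mono-≤ p≤0
  neg-square : ∀ p → (- p) · (- p) ≃ p · p
  neg-square = solve 1 (λ p → (:- p) :* (:- p) := p :* p) ≃-refl

≤-geometric-mean : ∀ {a p q} → 0ℚᵘ ≤ p → 0ℚᵘ ≤ q → a ≤ p · p → a ≤ q · q → a ≤ p · q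
≤-geometric-mean {a} {p} {q} 0≤p 0≤q a≤p² a≤q² with ℚP.≤-total p q
... | inj₁ p≤q = ℚP.≤-trans a≤p² (·-monoʳ-≤ 0≤p p≤q)
... | inj₂ q≤p = ℚP.≤-trans a≤q² (ℚP.≤-respʳ-≃ (*-comm q p) (·-monoʳ-≤ 0≤q q≤p))

p≃0⇒p·a≃p·b : ∀ {p} a b → p ≃ 0ℚᵘ → p · a ≃ p · b
p≃0⇒p·a≃p·b {p} a b p≃0 = ≃-trans (*-congʳ {a} p≃0) (≃-trans (*-zeroˡ a) (≃-sym (≃-trans (*-congʳ {b} p≃0) (*-zeroˡ b))))

nonNeg∧≄0⇒pos : ∀ {p} → 0ℚᵘ ≤ p → p ≄ 0ℚᵘ → 0ℚᵘ < p
nonNeg∧≄0⇒pos {p} 0≤p p≄0 with ℚP.<-cmp 0ℚᵘ p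
... | tri< 0<p _ _ = 0<p
... | tri≈ _ 0≃p _ = contradiction (≃-sym 0≃p) p≄0
... | tri> _ _ p<0 = contradiction 0≤p (ℚP.<⇒≱ p<0)

sumFinℚ≡sum : ∀ n (f : ℚⁿ n) → sumFinℚ n f ≡ sum f
sumFinℚ≡sum zero    f = refl
sumFinℚ≡sum (suc n) f = cong (f zero +_) (sumFinℚ≡sum n (λ i → f (suc i)))

toℚ-+ : ∀ m k → toℚ (m N.+ k) ≃ toℚ m + toℚ k
toℚ-+ m k = ≃-reflexive (cong (λ z → Q.mkℚᵘ z 0)
  (≡.trans (ℤP.pos-+ m k) (≡.sym (cong₂ ℤ._+_ (ℤP.*-identityʳ (ℤ.+ m)) (ℤP.*-identityʳ (ℤ.+ k))))))

toℚ-sumFin : ∀ n (f : Fin n → ℕ) → toℚ (sumFin n f) ≃ sum (λ i → toℚ (f i))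
toℚ-sumFin zero    f = ≃-refl
toℚ-sumFin (suc n) f = ≃-trans (toℚ-+ (f zero) _) (+-congʳ (toℚ (f zero)) (toℚ-sumFin n (λ i → f (suc i))))

sum-*-sum : ∀ {n} (f g : ℚⁿ n) → sum f · sum g ≃ sum (λ u → sum (λ v → f u · g v))
sum-*-sum f g = ≃-trans (*-distribʳ-sum (sum g) f) (sum-cong-≋ (λ u → *-distribˡ-sum (f u) g))

∑∑-distrib-+ : ∀ {n} (f g : Fin n → Fin n → ℚᵘ) →
               sum (λ u → sum (λ v → f u v + g u v)) ≃ sum (λ u → sum (f u)) + sum (λ u → sum (g u))
∑∑-distrib-+ f g = ≃-trans (sum-cong-≋ (λ u → ∑-distrib-+ (f u) (g u)))
                           (∑-distrib-+ (λ u → sum (f u)) (λ u → sum (g u)))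

sum-mono-≤ : ∀ {n} {f g : ℚⁿ n} → (∀ i → f i ≤ g i) → sum f ≤ sum g
sum-mono-≤ {zero}  _     = ℚP.≤-refl
sum-mono-≤ {suc n} f≤g = ℚP.+-mono-≤ (f≤g zero) (sum-mono-≤ (λ i → f≤g (suc i)))

sum-nonNeg : ∀ {n} {f : ℚⁿ n} → (∀ i → 0ℚᵘ ≤ f i) → 0ℚᵘ ≤ sum f
sum-nonNeg {zero}  _    = ℚP.≤-refl
sum-nonNeg {suc n} 0≤f = nonNeg-+ (0≤f zero) (sum-nonNeg (λ i → 0≤f (suc i)))

δ : ∀ {n} → Fin n → Fin n → ℚᵘ
δ zero    zero    = 1ℚᵘ
δ zero    (suc _) = 0ℚᵘ
δ (suc _) zero    = 0ℚᵘ
δ (suc u) (suc w) = δ u w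

δ-diag : ∀ {n} (u : Fin n) → δ u u ≡ 1ℚᵘ
δ-diag zero    = refl
δ-diag (suc u) = δ-diag u

δ-off : ∀ {n} {u w : Fin n} → u ≢ w → δ u w ≡ 0ℚᵘ
δ-off {u = zero}  {zero}  u≢w = contradiction refl u≢w
δ-off {u = zero}  {suc w} _   = refl
δ-off {u = suc u} {zero}  _   = refl
δ-off {u = suc u} {suc w} u≢w = δ-off (λ u≡w → u≢w (cong suc u≡w))

sum-δ : ∀ {n} (u : Fin n) (f : ℚⁿ n) → sum (λ w → δ u w · f w) ≃ f u
sum-δ {suc n} zero f = begin
  1ℚᵘ · f zero + sum (λ w → 0ℚᵘ · f (suc w))  ≈⟨ +-cong (*-identityˡ (f zero)) (sum-cong-≋ (λ w → *-zeroˡ (f (suc w)))) ⟩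
  f zero + sum {n} (λ _ → 0ℚᵘ)                 ≈⟨ +-congʳ (f zero) (sum-replicate-zero n) ⟩
  f zero + 0ℚᵘ                                 ≈⟨ +-identityʳ (f zero) ⟩
  f zero                                       ∎
  where open ≃-Reasoning
sum-δ {suc n} (suc u) f = begin
  0ℚᵘ · f zero + sum (λ w → δ u w · f (suc w))  ≈⟨ +-cong (*-zeroˡ (f zero)) (sum-δ u (λ w → f (suc w))) ⟩
  0ℚᵘ + f (suc u)                               ≈⟨ +-identityˡ (f (suc u)) ⟩
  f (suc u)                                     ∎
  where open ≃-Reasoning

infixl 6 _+ᵛ_
infixl 7 _·ᵛ_

_+ᵛ_ : ∀ {n} → ℚⁿ n → ℚⁿ n → ℚⁿ n
(x +ᵛ y) w = x w + y w

_·ᵛ_ : ∀ {n} → ℚᵘ → ℚⁿ n → ℚⁿ n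
(a ·ᵛ x) w = a · x w

dot : ∀ {n} → ℚⁿ n → ℚⁿ n → ℚᵘ
dot x y = sum (λ w → x w · y w)

dot-comm : ∀ {n} (x y : ℚⁿ n) → dot x y ≃ dot y x
dot-comm x y = sum-cong-≋ (λ w → *-comm (x w) (y w))

dot-congʳ : ∀ {n} (x : ℚⁿ n) {y z} → (∀ w → y w ≃ z w) → dot x y ≃ dot x z
dot-congʳ x y≃z = sum-cong-≋ (λ w → *-congˡ {x w} (y≃z w))

dot-linearˡ : ∀ {n} a (x : ℚⁿ n) b y z → dot (a ·ᵛ x +ᵛ b ·ᵛ y) z ≃ a · dot x z + b · dot y z
dot-linearˡ a x b y z = begin
  sum (λ w → (a · x w + b · y w) · z w)              ≈⟨ sum-cong-≋ (λ w → distrib (x w) (y w) (z w)) ⟩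
  sum (λ w → a · (x w · z w) + b · (y w · z w))      ≈⟨ ∑-distrib-+ (λ w → a · (x w · z w)) (λ w → b · (y w · z w)) ⟩
  sum (λ w → a · (x w · z w)) + sum (λ w → b · (y w · z w))
    ≈⟨ +-cong (≃-sym (*-distribˡ-sum a (λ w → x w · z w))) (≃-sym (*-distribˡ-sum b (λ w → y w · z w))) ⟩
  a · dot x z + b · dot y z                          ∎
  where
  open ≃-Reasoning
  distrib : ∀ p q r → (a · p + b · q) · r ≃ a · (p · r) + b · (q · r)
  distrib = solve 5 (λ a b p q r → (a :* p :+ b :* q) :* r := a :* (p :* r) :+ b :* (q :* r)) ≃-refl a b

-- Lagrange's identity: the double sum of the squares (f u g v - f v g u)² is 2 (f·f)(g·g) - 2 (f·g)².
cauchy-schwarz : ∀ {n} (f g : ℚⁿ n) → dot f g · dot f g ≤ dot f f · dot g g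
cauchy-schwarz f g = ·-cancelˡ-≤ (ℚP.positive⁻¹ two) (begin
  two · X                   ≃⟨ double X ⟩
  X + X                     ≤⟨ ℚP.p≤q+p (X + X) L {{Q.nonNegative 0≤L}} ⟩
  L + (X + X)               ≃⟨ lagrange ⟩
  Y + Y                     ≃⟨ double Y ⟨
  two · Y                   ∎)
  where
  open ℚP.≤-Reasoning
  two = 1ℚᵘ + 1ℚᵘ
  X = dot f g · dot f g
  Y = dot f f · dot g g
  cross : Fin _ → Fin _ → ℚᵘ
  cross u v = f u · g v - f v · g u
  L = sum (λ u → sum (λ v → cross u v · cross u v))
  0≤L : 0ℚᵘ ≤ L
  0≤L = sum-nonNeg (λ u → sum-nonNeg (λ v → square-nonNeg (cross u v)))
  double : ∀ p → two · p ≃ p + p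
  double = solve 1 (λ p → (con 1ℚᵘ :+ con 1ℚᵘ) :* p := p :+ p) ≃-refl
  pointwise : ∀ fu fv gu gv → (fu · gv - fv · gu) · (fu · gv - fv · gu) + ((fu · gu) · (fv · gv) + (fu · gu) · (fv · gv))
                              ≃ (fu · fu) · (gv · gv) + (gu · gu) · (fv · fv)
  pointwise = solve 4 (λ fu fv gu gv →
    (fu :* gv :- fv :* gu) :* (fu :* gv :- fv :* gu) :+ ((fu :* gu) :* (fv :* gv) :+ (fu :* gu) :* (fv :* gv))
      := (fu :* fu) :* (gv :* gv) :+ (gu :* gu) :* (fv :* fv)) ≃-refl
  lagrange : L + (X + X) ≃ Y + Y
  lagrange = begin-equality
    L + (X + X)                                     ≃⟨ +-congʳ L (+-cong X≃∑∑P X≃∑∑P) ⟩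
    L + (∑∑ P + ∑∑ P)                               ≃⟨ +-congʳ L (∑∑-distrib-+ P P) ⟨
    L + ∑∑ (λ u v → P u v + P u v)
      ≃⟨ ∑∑-distrib-+ (λ u v → cross u v · cross u v) (λ u v → P u v + P u v) ⟨
    ∑∑ (λ u v → cross u v · cross u v + (P u v + P u v))
      ≃⟨ sum-cong-≋ (λ u → sum-cong-≋ (λ v → pointwise (f u) (f v) (g u) (g v))) ⟩
    ∑∑ (λ u v → (f u · f u) · (g v · g v) + (g u · g u) · (f v · f v))
      ≃⟨ ∑∑-distrib-+ (λ u v → (f u · f u) · (g v · g v)) (λ u v → (g u · g u) · (f v · f v)) ⟩
    ∑∑ (λ u v → (f u · f u) · (g v · g v)) + ∑∑ (λ u v → (g u · g u) · (f v · f v))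
      ≃⟨ +-cong (sum-*-sum (λ u → f u · f u) (λ v → g v · g v))
                (≃-trans (*-comm (dot f f) (dot g g)) (sum-*-sum (λ u → g u · g u) (λ v → f v · f v))) ⟨
    Y + Y                                           ∎
    where
    ∑∑ : (Fin _ → Fin _ → ℚᵘ) → ℚᵘ
    ∑∑ h = sum (λ u → sum (h u))
    P : Fin _ → Fin _ → ℚᵘ
    P u v = (f u · g u) · (f v · g v)
    X≃∑∑P : X ≃ ∑∑ P
    X≃∑∑P = sum-*-sum (λ u → f u · g u) (λ v → f v · g v)

-- Expanding both squares as double sums, it suffices that α ≤ t u · t v on the support of x.
scaled-sum²≤dot² : ∀ {n} {α} {x t : ℚⁿ n} → (∀ w → 0ℚᵘ ≤ x w) → (∀ w → 0ℚᵘ ≤ t w) →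
                   (∀ u → x u ≄ 0ℚᵘ → α ≤ t u · t u) → α · (sum x · sum x) ≤ dot x t · dot x t
scaled-sum²≤dot² {α = α} {x} {t} 0≤x 0≤t α≤t² = begin
  α · (sum x · sum x)                                 ≃⟨ *-congˡ {α} (sum-*-sum x x) ⟩
  α · sum (λ u → sum (λ v → x u · x v))               ≃⟨ *-distribˡ-sum α (λ u → sum (λ v → x u · x v)) ⟩
  sum (λ u → α · sum (λ v → x u · x v))               ≃⟨ sum-cong-≋ (λ u → *-distribˡ-sum α (λ v → x u · x v)) ⟩
  sum (λ u → sum (λ v → α · (x u · x v)))             ≤⟨ sum-mono-≤ (λ u → sum-mono-≤ (λ v → pointwise u v)) ⟩
  sum (λ u → sum (λ v → (x u · t u) · (x v · t v)))   ≃⟨ sum-*-sum (λ u → x u · t u) (λ v → x v · t v) ⟨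
  dot x t · dot x t                                   ∎
  where
  open ℚP.≤-Reasoning
  pointwise : ∀ u v → α · (x u · x v) ≤ (x u · t u) · (x v · t v)
  pointwise u v = ℚP.≤-respˡ-≃ (*-comm (x u · x v) α) (ℚP.≤-respʳ-≃ (swap (x u) (x v) (t u) (t v)) factored)
    where
    swap : ∀ a b c d → (a · b) · (c · d) ≃ (a · c) · (b · d)
    swap = solve 4 (λ a b c d → (a :* b) :* (c :* d) := (a :* c) :* (b :* d)) ≃-refl
    factored : (x u · x v) · α ≤ (x u · x v) · (t u · t v)
    factored with x u ≃? 0ℚᵘ | x v ≃? 0ℚᵘ
    ... | yes xu≃0 | _        = ℚP.≤-reflexive (p≃0⇒p·a≃p·b α _ (≃-trans (*-congʳ {x v} xu≃0) (*-zeroˡ (x v))))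
    ... | no _     | yes xv≃0 = ℚP.≤-reflexive (p≃0⇒p·a≃p·b α _ (≃-trans (*-congˡ {x u} xv≃0) (*-zeroʳ (x u))))
    ... | no xu≄0  | no xv≄0  =
      ·-monoʳ-≤ (nonNeg-· (0≤x u) (0≤x v)) (≤-geometric-mean (0≤t u) (0≤t v) (α≤t² u xu≄0) (α≤t² v xv≄0))

indicator : ∀ {n} → Subset n → ℚⁿ n
indicator S w = if lookup S w then 1ℚᵘ else 0ℚᵘ

sum-indicator : ∀ {n} (S : Subset n) → sum (indicator S) ≃ toℚ ∣ S ∣
sum-indicator []            = ≃-refl
sum-indicator (inside ∷ S)  = ≃-trans (+-congʳ 1ℚᵘ (sum-indicator S)) (≃-sym (toℚ-+ 1 ∣ S ∣))
sum-indicator (outside ∷ S) = ≃-trans (+-identityˡ _) (sum-indicator S)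

lookup≡outside⇒∉ : ∀ {n} {S : Subset n} {w} → lookup S w ≡ outside → w ∉ S
lookup≡outside⇒∉ S[w]≡outside w∈S = contradiction (≡.trans (≡.sym ([]=⇒lookup w∈S)) S[w]≡outside) λ ()

indicator-idem : ∀ {n} (S : Subset n) w → indicator S w · indicator S w ≃ indicator S w
indicator-idem S w with lookup S w
... | inside  = *-identityˡ 1ℚᵘ
... | outside = *-zeroˡ 0ℚᵘ

indicator-absorb : ∀ {n} {S : Subset n} {x : ℚⁿ n} → (∀ w → w ∉ S → x w ≃ 0ℚᵘ) → ∀ w → indicator S w · x w ≃ x w
indicator-absorb {S = S} {x} vanish w with lookup S w in S[w]
... | inside  = *-identityˡ (x w)
... | outside = ≃-trans (*-zeroˡ (x w)) (≃-sym (vanish w (lookup≡outside⇒∉ S[w])))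

sum²≤∣S∣·dot : ∀ {n} {S : Subset n} {x : ℚⁿ n} → (∀ w → w ∉ S → x w ≃ 0ℚᵘ) → sum x · sum x ≤ toℚ ∣ S ∣ · dot x x
sum²≤∣S∣·dot {S = S} {x} vanish =
  ℚP.≤-respˡ-≃ (*-cong ∑𝟙x ∑𝟙x) (ℚP.≤-respʳ-≃ (*-congʳ {dot x x} ∑𝟙𝟙) (cauchy-schwarz (indicator S) x))
  where
  ∑𝟙x : dot (indicator S) x ≃ sum x
  ∑𝟙x = sum-cong-≋ (indicator-absorb vanish)
  ∑𝟙𝟙 : dot (indicator S) (indicator S) ≃ toℚ ∣ S ∣
  ∑𝟙𝟙 = ≃-trans (sum-cong-≋ (indicator-idem S)) (sum-indicator S)

support : ∀ {n} → ℚⁿ n → Subset n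
support x = tabulate (λ w → does (¬? (x w ≃? 0ℚᵘ)))

module _ {n} (x : ℚⁿ n) {w : Fin n} where

  ∈-support⁺ : x w ≄ 0ℚᵘ → w ∈ support x
  ∈-support⁺ xw≄0 = lookup⇒[]= w (support x) (≡.trans (lookup∘tabulate _ w) (dec-true (¬? (x w ≃? 0ℚᵘ)) xw≄0))

  ∈-support⁻ : w ∈ support x → x w ≄ 0ℚᵘ
  ∈-support⁻ w∈ xw≃0 = contradiction (≡.trans (≡.sym nonzero) (dec-false (¬? (x w ≃? 0ℚᵘ)) (λ xw≄0 → xw≄0 xw≃0))) λ ()
    where
    nonzero : does (¬? (x w ≃? 0ℚᵘ)) ≡ inside
    nonzero = ≡.trans (≡.sym (lookup∘tabulate _ w)) ([]=⇒lookup w∈)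

  ∉-support : w ∉ support x → x w ≃ 0ℚᵘ
  ∉-support w∉ = decidable-stable (x w ≃? 0ℚᵘ) (λ xw≄0 → w∉ (∈-support⁺ xw≄0))

support-⊂ : ∀ {n} {x y : ℚⁿ n} {v} → (∀ w → x w ≃ 0ℚᵘ → y w ≃ 0ℚᵘ) → v ∈ support x → y v ≃ 0ℚᵘ →
            support y ⊂ support x
support-⊂ {x = x} {y} {v} vanish v∈x yv≃0 =
  (λ w∈y → ∈-support⁺ x (λ xw≃0 → ∈-support⁻ y w∈y (vanish _ xw≃0))) , v , v∈x ,
  (λ v∈y → ∈-support⁻ y v∈y yv≃0)

module QuadraticForm {n} (M : Fin n → Fin n → ℚᵘ) (M-sym : ∀ u v → M u v ≃ M v u) where

  M⋅_ : ℚⁿ n → ℚⁿ n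
  (M⋅ y) u = dot (M u) y

  form : ℚⁿ n → ℚⁿ n → ℚᵘ
  form x y = dot x (M⋅ y)

  form-sym : ∀ x y → form x y ≃ form y x
  form-sym x y = begin
    sum (λ u → x u · sum (λ w → M u w · y w))        ≈⟨ sum-cong-≋ (λ u → *-distribˡ-sum (x u) (λ w → M u w · y w)) ⟩
    sum (λ u → sum (λ w → x u · (M u w · y w)))      ≈⟨ ∑-comm (λ u w → x u · (M u w · y w)) ⟩
    sum (λ w → sum (λ u → x u · (M u w · y w)))      ≈⟨ sum-cong-≋ (λ w → sum-cong-≋ (λ u → swap (x u) (y w) (M-sym u w))) ⟩
    sum (λ w → sum (λ u → y w · (M w u · x u)))      ≈⟨ sum-cong-≋ (λ w → *-distribˡ-sum (y w) (λ u → M w u · x u)) ⟨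
    sum (λ w → y w · sum (λ u → M w u · x u))        ∎
    where
    open ≃-Reasoning
    swap : ∀ p q {m m′} → m ≃ m′ → p · (m · q) ≃ q · (m′ · p)
    swap p q {m} {m′} m≃m′ = ≃-trans (*-congˡ {p} (*-congʳ {q} m≃m′))
      (solve 3 (λ p q m → p :* (m :* q) := q :* (m :* p)) ≃-refl p q m′)

  form-linearˡ : ∀ a x b y z → form (a ·ᵛ x +ᵛ b ·ᵛ y) z ≃ a · form x z + b · form y z
  form-linearˡ a x b y z = dot-linearˡ a x b y (M⋅ z)

  form-linearʳ : ∀ z a x b y → form z (a ·ᵛ x +ᵛ b ·ᵛ y) ≃ a · form z x + b · form z y
  form-linearʳ z a x b y = ≃-trans (form-sym z _) (≃-trans (form-linearˡ a x b y z)
    (+-cong (*-congˡ {a} (form-sym x z)) (*-congˡ {b} (form-sym y z))))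

  form-bilinear : ∀ a x b y c z d w →
                  form (a ·ᵛ x +ᵛ b ·ᵛ y) (c ·ᵛ z +ᵛ d ·ᵛ w)
                    ≃ a · (c · form x z + d · form x w) + b · (c · form y z + d · form y w)
  form-bilinear a x b y c z d w = ≃-trans (form-linearˡ a x b y _)
    (+-cong (*-congˡ {a} (form-linearʳ x c z d w)) (*-congˡ {b} (form-linearʳ y c z d w)))

  form-δˡ : ∀ u y → form (δ u) y ≃ (M⋅ y) u
  form-δˡ u y = sum-δ u (M⋅ y)

  form-δδ : ∀ u v → form (δ u) (δ v) ≃ M u v
  form-δδ u v = ≃-trans (form-δˡ u (δ v)) (≃-trans (dot-comm (M u) (δ v)) (sum-δ v (M u)))

  form-δʳ : ∀ x u → form x (δ u) ≃ (M⋅ x) u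
  form-δʳ x u = ≃-trans (form-sym x (δ u)) (form-δˡ u x)

  form-pair-isotropic : ∀ {u v} α β → M u u ≃ 0ℚᵘ → M u v ≃ 0ℚᵘ → M v v ≃ 0ℚᵘ →
                        form (α ·ᵛ δ u +ᵛ β ·ᵛ δ v) (α ·ᵛ δ u +ᵛ β ·ᵛ δ v) ≃ 0ℚᵘ
  form-pair-isotropic {u} {v} α β Muu≃0 Muv≃0 Mvv≃0 = begin
    form (α ·ᵛ δ u +ᵛ β ·ᵛ δ v) (α ·ᵛ δ u +ᵛ β ·ᵛ δ v)
      ≈⟨ form-bilinear α (δ u) β (δ v) α (δ u) β (δ v) ⟩
    α · (α · form (δ u) (δ u) + β · form (δ u) (δ v)) + β · (α · form (δ v) (δ u) + β · form (δ v) (δ v))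
      ≈⟨ +-cong (*-congˡ {α} (+-cong (*-congˡ {α} Fuu) (*-congˡ {β} Fuv)))
                (*-congˡ {β} (+-cong (*-congˡ {α} Fvu) (*-congˡ {β} Fvv))) ⟩
    α · (α · 0ℚᵘ + β · 0ℚᵘ) + β · (α · 0ℚᵘ + β · 0ℚᵘ)
      ≈⟨ solve 2 (λ α β → α :* (α :* con 0ℚᵘ :+ β :* con 0ℚᵘ) :+ β :* (α :* con 0ℚᵘ :+ β :* con 0ℚᵘ) := con 0ℚᵘ) ≃-refl α β ⟩
    0ℚᵘ ∎
    where
    open ≃-Reasoning
    Fuu = ≃-trans (form-δδ u u) Muu≃0
    Fuv = ≃-trans (form-δδ u v) Muv≃0
    Fvu = ≃-trans (form-δδ v u) (≃-trans (M-sym v u) Muv≃0)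
    Fvv = ≃-trans (form-δδ v v) Mvv≃0

  BoundedBy : ℚⁿ n → ℚⁿ n → Set
  BoundedBy t x = form x x ≤ dot x t · dot x t

  -- form (k x + μ d) ≥ k² form x x, while dot (k x + μ d) t = k dot x t.
  perturbed-bound⇒bound : ∀ t {k μ} x d → 0ℚᵘ < k → dot d t ≃ 0ℚᵘ → form d d ≃ 0ℚᵘ → 0ℚᵘ ≤ μ · form x d →
                          BoundedBy t (k ·ᵛ x +ᵛ μ ·ᵛ d) → BoundedBy t x
  perturbed-bound⇒bound t {k} {μ} x d 0<k td≃0 dd≃0 0≤μxd bound-y =
    ·-cancelˡ-≤ 0<k (·-cancelˡ-≤ 0<k (begin
      k · (k · form x x)                    ≤⟨ p≤p+q _ (nonNeg-+ k·μxd≥0 k·μxd≥0) ⟩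
      k · (k · form x x) + (k · (μ · form x d) + k · (μ · form x d))  ≃⟨ form-y ⟨
      form y y                              ≤⟨ bound-y ⟩
      dot y t · dot y t                     ≃⟨ *-cong dot-y dot-y ⟩
      (k · dot x t) · (k · dot x t)         ≃⟨ square-scale k (dot x t) ⟩
      k · (k · (dot x t · dot x t))         ∎))
    where
    open ℚP.≤-Reasoning
    y = k ·ᵛ x +ᵛ μ ·ᵛ d
    k·μxd≥0 : 0ℚᵘ ≤ k · (μ · form x d)
    k·μxd≥0 = nonNeg-· (ℚP.<⇒≤ 0<k) 0≤μxd
    square-scale : ∀ k p → (k · p) · (k · p) ≃ k · (k · (p · p))
    square-scale = solve 2 (λ k p → (k :* p) :* (k :* p) := k :* (k :* (p :* p))) ≃-refl
    form-y : form y y ≃ k · (k · form x x) + (k · (μ · form x d) + k · (μ · form x d))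
    form-y = ≃-trans (form-bilinear k x μ d k x μ d)
      (≃-trans (+-congʳ (k · (k · form x x + μ · form x d))
                        (*-congˡ {μ} (+-cong (*-congˡ {k} (form-sym d x)) (*-congˡ {μ} dd≃0))))
        (solve 4 (λ k μ F G → k :* (k :* F :+ μ :* G) :+ μ :* (k :* G :+ μ :* con 0ℚᵘ)
                              := k :* (k :* F) :+ (k :* (μ :* G) :+ k :* (μ :* G))) ≃-refl k μ (form x x) (form x d)))
    dot-y : dot y t ≃ k · dot x t
    dot-y = ≃-trans (dot-linearˡ k x μ d t)
      (≃-trans (+-congʳ (k · dot x t) (*-congˡ {μ} td≃0))
        (solve 3 (λ k μ T → k :* T :+ μ :* con 0ℚᵘ := k :* T) ≃-refl k μ (dot x t)))

cRatio-mono : ∀ {K C} → K N.≤ C → cRatio K ≤ cRatio C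
cRatio-mono {zero}  {C}     _             = ℚP.nonNegative⁻¹ (cRatio C)
cRatio-mono {suc j} {suc l} (N.s≤s j≤l) =
  Q.*≤* (≡.subst₂ ℤ._≤_ (ℤP.pos-* j (suc l)) (ℤP.pos-* l (suc j)) (ℤ.+≤+ j[l+1]≤l[j+1]))
  where
  j[l+1]≤l[j+1] : j N.* suc l N.≤ l N.* suc j
  j[l+1]≤l[j+1] = ≡.subst₂ N._≤_ (≡.sym (NP.*-suc j l)) (≡.sym (NP.*-suc l j))
                    (NP.+-mono-≤ j≤l (NP.≤-reflexive (NP.*-comm j l)))

cRatio-pos : ∀ {c} → 2 N.≤ c → 0ℚᵘ < cRatio c
cRatio-pos {suc zero}    (N.s≤s ())
cRatio-pos {suc (suc l)} _ = ℚP.positive⁻¹ (cRatio (suc (suc l)))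

toℚ-suc·cRatio : ∀ j → toℚ (suc j) · cRatio (suc j) ≃ toℚ j
toℚ-suc·cRatio j = Q.*≡* (≡.trans (identity (ℤ.+ j)) (cong (λ m → ℤ.+ j ℤ.* ℤ.+ suc m) (≡.sym (NP.+-identityʳ j))))
  where
  identity : ∀ J → ((ℤ.1ℤ ℤ.+ J) ℤ.* J) ℤ.* ℤ.1ℤ ≡ J ℤ.* (ℤ.1ℤ ℤ.+ J)
  identity = solve-∀

cRatio-bound : ∀ K {F q S} → 0ℚᵘ ≤ q → F + q ≃ S → S ≤ toℚ K · q → F ≤ cRatio K · S
cRatio-bound zero {F} {q} {S} 0≤q F+q≃S S≤0·q = begin
  F           ≤⟨ p≤p+q F 0≤q ⟩
  F + q       ≃⟨ F+q≃S ⟩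
  S           ≤⟨ S≤0·q ⟩
  0ℚᵘ · q     ≃⟨ *-zeroˡ q ⟩
  0ℚᵘ         ≃⟨ *-zeroˡ S ⟨
  0ℚᵘ · S     ∎
  where open ℚP.≤-Reasoning
cRatio-bound (suc j) {F} {q} {S} 0≤q F+q≃S S≤kq = ·-cancelˡ-≤ (ℚP.positive⁻¹ k) (+-cancelʳ-≤ S (begin
  k · F + S             ≤⟨ ℚP.+-monoʳ-≤ (k · F) S≤kq ⟩
  k · F + k · q         ≃⟨ *-distribˡ-+ k F q ⟨
  k · (F + q)           ≃⟨ *-congˡ {k} F+q≃S ⟩
  k · S                 ≃⟨ *-congʳ {S} (toℚ-+ 1 j) ⟩
  (1ℚᵘ + toℚ j) · S     ≃⟨ *-congʳ {S} (+-congʳ 1ℚᵘ (toℚ-suc·cRatio j)) ⟨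
  (1ℚᵘ + k · α) · S     ≃⟨ solve 3 (λ k α S → (con 1ℚᵘ :+ k :* α) :* S := k :* (α :* S) :+ S) ≃-refl k α S ⟩
  k · (α · S) + S       ∎))
  where
  open ℚP.≤-Reasoning
  k = toℚ (suc j)
  α = cRatio (suc j)

module AdjacencyForm {n} (G : SimpleGraph n) where

  A : Fin n → Fin n → ℚᵘ
  A u v = if Adj G u v then 1ℚᵘ else 0ℚᵘ

  A-value : ∀ {u v b} → Adj G u v ≡ b → A u v ≃ (if b then 1ℚᵘ else 0ℚᵘ)
  A-value uv≡b = ≃-reflexive (cong (λ b → if b then 1ℚᵘ else 0ℚᵘ) uv≡b)

  A-sym : ∀ u v → A u v ≃ A v u
  A-sym u v = A-value (sym G u v)

  A-irrefl : ∀ u → A u u ≃ 0ℚᵘ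
  A-irrefl u = A-value (irrefl G u)

  open QuadraticForm A A-sym public

  -- W r v = w_{r+1}(v) counts the walks with r edges starting at v.
  W : ℕ → ℚⁿ n
  W r v = toℚ (walks G (suc r) v)

  W-suc : ∀ r v → W (suc r) v ≃ (M⋅ W r) v
  W-suc r v = ≃-trans (toℚ-sumFin n _) (sum-cong-≋ (λ u → toℚ-if (Adj G v u) (walks G (suc r) u)))
    where
    toℚ-if : ∀ b m → toℚ (if b then m else 0) ≃ (if b then 1ℚᵘ else 0ℚᵘ) · toℚ m
    toℚ-if true  m = ≃-sym (*-identityˡ (toℚ m))
    toℚ-if false m = ≃-sym (*-zeroˡ (toℚ m))

  dot-W-step : ∀ p q → dot (W p) (W (suc q)) ≃ dot (W (suc p)) (W q)
  dot-W-step p q = begin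
    dot (W p) (W (suc q))   ≈⟨ dot-congʳ (W p) (W-suc q) ⟩
    form (W p) (W q)        ≈⟨ form-sym (W p) (W q) ⟩
    form (W q) (W p)        ≈⟨ dot-congʳ (W q) (W-suc p) ⟨
    dot (W q) (W (suc p))   ≈⟨ dot-comm (W q) (W (suc p)) ⟩
    dot (W (suc p)) (W q)   ∎
    where open ≃-Reasoning

  dot-W-shift : ∀ i p q → dot (W p) (W (i N.+ q)) ≃ dot (W (i N.+ p)) (W q)
  dot-W-shift zero    p q = ≃-refl
  dot-W-shift (suc i) p q = begin
    dot (W p) (W (suc (i N.+ q)))   ≈⟨ dot-W-step p (i N.+ q) ⟩
    dot (W (suc p)) (W (i N.+ q))   ≈⟨ dot-W-shift i (suc p) q ⟩
    dot (W (i N.+ suc p)) (W q)     ≡⟨ cong (λ m → dot (W m) (W q)) (NP.+-suc i p) ⟩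
    dot (W (suc (i N.+ p))) (W q)   ∎
    where open ≃-Reasoning

  totalWalks[2r]≃form : ∀ k → toℚ (totalWalks G (2 * suc k)) ≃ form (W k) (W k)
  totalWalks[2r]≃form k = begin
    toℚ (totalWalks G (2 * suc k))             ≈⟨ toℚ-sumFin n (walks G (2 * suc k)) ⟩
    sum (λ v → toℚ (walks G (2 * suc k) v))    ≡⟨ cong (λ m → sum (λ v → toℚ (walks G (suc m) v))) k+[k+1] ⟩
    sum (W (k N.+ suc k))                      ≈⟨ sum-cong-≋ (λ v → *-identityˡ (W (k N.+ suc k) v)) ⟨
    dot (W 0) (W (k N.+ suc k))                ≈⟨ dot-W-shift k 0 (suc k) ⟩
    dot (W (k N.+ 0)) (W (suc k))              ≡⟨ cong (λ m → dot (W m) (W (suc k))) (NP.+-identityʳ k) ⟩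
    dot (W k) (W (suc k))                      ≈⟨ dot-congʳ (W k) (W-suc k) ⟩
    form (W k) (W k)                           ∎
    where
    open ≃-Reasoning
    k+[k+1] : k N.+ suc (k N.+ 0) ≡ k N.+ suc k
    k+[k+1] = cong (λ m → k N.+ suc m) (NP.+-identityʳ k)

  edge⇒2≤cliqueOrder : ∀ {u w k} → Adj G u w ≡ true → IsMaxCliqueOrderAt G u k → 2 N.≤ k
  edge⇒2≤cliqueOrder {u} {w} uw (_ , maximal) = NP.≤-trans 2≤∣S∣ (maximal S S-clique u∈S)
    where
    S = ⁅ u ⁆ ∪ ⁅ w ⁆
    u≢w : u ≢ w
    u≢w refl = contradiction (≡.trans (≡.sym uw) (irrefl G u)) λ ()
    u∈S : u ∈ S
    u∈S = x∈p∪q⁺ (inj₁ (x∈⁅x⁆ u))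
    ∈S⇒≡ : ∀ {i} → i ∈ S → i ≡ u ⊎ i ≡ w
    ∈S⇒≡ i∈S = Sum.map (x∈⁅y⁆⇒x≡y u) (x∈⁅y⁆⇒x≡y w) (x∈p∪q⁻ ⁅ u ⁆ ⁅ w ⁆ i∈S)
    S-clique : IsClique G S
    S-clique i j i∈S j∈S i≢j with ∈S⇒≡ i∈S | ∈S⇒≡ j∈S
    ... | inj₁ refl | inj₁ refl = contradiction refl i≢j
    ... | inj₁ refl | inj₂ refl = uw
    ... | inj₂ refl | inj₁ refl = ≡.trans (sym G w u) uw
    ... | inj₂ refl | inj₂ refl = contradiction refl i≢j
    2≤∣S∣ : 2 N.≤ ∣ S ∣
    2≤∣S∣ = ≡.subst (λ m → suc m N.≤ ∣ S ∣) (∣⁅x⁆∣≡1 w)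
              (p⊂q⇒∣p∣<∣q∣ (q⊆p∪q ⁅ u ⁆ ⁅ w ⁆ , u , u∈S , x≢y⇒x∉⁅y⁆ u≢w))

  NonadjacentPairIn : Subset n → Set
  NonadjacentPairIn S = ∃₂ λ u v → u ∈ S × v ∈ S × u ≢ v × Adj G u v ≡ false

  clique-or-nonadjacent : ∀ S → IsClique G S ⊎ NonadjacentPairIn S
  clique-or-nonadjacent S
    with any? (λ u → any? (λ v → u ∈? S ×-dec v ∈? S ×-dec ¬? (u ≟ v) ×-dec Adj G u v ≟ᵇ false))
  ... | yes (u , v , pair) = inj₂ (u , v , pair)
  ... | no no-pair         = inj₁ clique
    where
    clique : IsClique G S
    clique u v u∈S v∈S u≢v with Adj G u v in uv
    ... | true  = refl
    ... | false = contradiction (u , v , u∈S , v∈S , u≢v , uv) no-pair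

  A+δ≃1 : ∀ {S} → IsClique G S → ∀ {v w} → v ∈ S → w ∈ S → A v w + δ v w ≃ 1ℚᵘ
  A+δ≃1 S-clique {v} {w} v∈S w∈S with v ≟ w
  ... | yes refl = ≃-trans (+-cong (A-irrefl v) (≃-reflexive (δ-diag v))) (+-identityˡ 1ℚᵘ)
  ... | no v≢w   = ≃-trans (+-cong (A-value (S-clique v w v∈S w∈S v≢w)) (≃-reflexive (δ-off v≢w))) (+-identityʳ 1ℚᵘ)

  clique-row : ∀ {x} → IsClique G (support x) → ∀ {v} → v ∈ support x → (M⋅ x) v + x v ≃ sum x
  clique-row {x} clique {v} v∈ = begin
    dot (A v) x + x v                                  ≈⟨ +-congʳ (dot (A v) x) (sum-δ v x) ⟨
    dot (A v) x + sum (λ w → δ v w · x w)              ≈⟨ ∑-distrib-+ (λ w → A v w · x w) (λ w → δ v w · x w) ⟨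
    sum (λ w → A v w · x w + δ v w · x w)              ≈⟨ sum-cong-≋ (λ w → *-distribʳ-+ (x w) (A v w) (δ v w)) ⟨
    sum (λ w → (A v w + δ v w) · x w)                  ≈⟨ sum-cong-≋ pointwise ⟩
    sum x                                              ∎
    where
    open ≃-Reasoning
    pointwise : ∀ w → (A v w + δ v w) · x w ≃ x w
    pointwise w with w ∈? support x
    ... | yes w∈ = ≃-trans (*-congʳ {x w} (A+δ≃1 clique v∈ w∈)) (*-identityˡ (x w))
    ... | no w∉  = ≃-trans (*-congˡ {A v w + δ v w} xw≃0) (≃-trans (*-zeroʳ (A v w + δ v w)) (≃-sym xw≃0))
      where xw≃0 = ∉-support x w∉

  clique-form : ∀ {x} → IsClique G (support x) → form x x + dot x x ≃ sum x · sum x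
  clique-form {x} clique = begin
    form x x + dot x x                         ≈⟨ ∑-distrib-+ (λ v → x v · (M⋅ x) v) (λ v → x v · x v) ⟨
    sum (λ v → x v · (M⋅ x) v + x v · x v)     ≈⟨ sum-cong-≋ (λ v → *-distribˡ-+ (x v) ((M⋅ x) v) (x v)) ⟨
    sum (λ v → x v · ((M⋅ x) v + x v))         ≈⟨ sum-cong-≋ pointwise ⟩
    sum (λ v → x v · sum x)                    ≈⟨ *-distribʳ-sum (sum x) x ⟨
    sum x · sum x                              ∎
    where
    open ≃-Reasoning
    pointwise : ∀ v → x v · ((M⋅ x) v + x v) ≃ x v · sum x
    pointwise v with v ∈? support x
    ... | yes v∈ = *-congˡ {x v} (clique-row clique v∈)
    ... | no v∉  = p≃0⇒p·a≃p·b ((M⋅ x) v + x v) (sum x) (∉-support x v∉)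

  clique-form≤cRatio·sum² : ∀ {x} → IsClique G (support x) → form x x ≤ cRatio ∣ support x ∣ · (sum x · sum x)
  clique-form≤cRatio·sum² {x} clique =
    cRatio-bound ∣ support x ∣ (sum-nonNeg (λ w → square-nonNeg (x w))) (clique-form clique)
      (sum²≤∣S∣·dot {S = support x} (λ w → ∉-support x))

module WeightedMotzkinStraus {n} (G : SimpleGraph n) (c : Fin n → ℕ) (c-max : ∀ v → IsMaxCliqueOrderAt G v (c v))
                             (t : ℚⁿ n) (0≤t : ∀ v → 0ℚᵘ ≤ t v) (cRatio≤t² : ∀ v → cRatio (c v) ≤ t v · t v) where

  open AdjacencyForm G

  NonNeg : ℚⁿ n → Set
  NonNeg x = ∀ w → 0ℚᵘ ≤ x w

  Bounded : ℚⁿ n → Set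
  Bounded = BoundedBy t

  SmallerSupportsBounded : ℚⁿ n → Set
  SmallerSupportsBounded x = ∀ {y} → support y ⊂ support x → NonNeg y → Bounded y

  clique-bounded : ∀ {x} → IsClique G (support x) → NonNeg x → Bounded x
  clique-bounded {x} clique 0≤x =
    ℚP.≤-trans (clique-form≤cRatio·sum² clique) (scaled-sum²≤dot² 0≤x 0≤t cRatio≤t²-on-support)
    where
    cRatio≤t²-on-support : ∀ u → x u ≄ 0ℚᵘ → cRatio ∣ support x ∣ ≤ t u · t u
    cRatio≤t²-on-support u xu≄0 =
      ℚP.≤-trans (cRatio-mono (proj₂ (c-max u) (support x) clique (∈-support⁺ x xu≄0))) (cRatio≤t² u)

  weightless⇒isolated : ∀ {u} → t u ≃ 0ℚᵘ → ∀ w → Adj G u w ≡ false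
  weightless⇒isolated {u} tu≃0 w with Adj G u w in uw
  ... | false = refl
  ... | true  =
    contradiction (ℚP.<-≤-trans (cRatio-pos (edge⇒2≤cliqueOrder uw (c-max u))) cRatio≤0) (ℚP.<-irrefl ≃-refl)
    where
    cRatio≤0 : cRatio (c u) ≤ 0ℚᵘ
    cRatio≤0 = ℚP.≤-respʳ-≃ (≃-trans (*-cong tu≃0 tu≃0) (*-zeroˡ 0ℚᵘ)) (cRatio≤t² u)

  clearing-shrinks-support : ∀ {x y v} → v ∈ support x → y v ≃ 0ℚᵘ →
                             (∀ w → w ≢ v → 0ℚᵘ ≤ y w × (x w ≃ 0ℚᵘ → y w ≃ 0ℚᵘ)) →
                             support y ⊂ support x × NonNeg y
  clearing-shrinks-support {x} {y} {v} v∈ yv≃0 elsewhere = support-⊂ vanish v∈ yv≃0 , nonNeg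
    where
    vanish : ∀ w → x w ≃ 0ℚᵘ → y w ≃ 0ℚᵘ
    vanish w xw≃0 with w ≟ v
    ... | yes refl = yv≃0
    ... | no w≢v   = proj₂ (elsewhere w w≢v) xw≃0
    nonNeg : NonNeg y
    nonNeg w with w ≟ v
    ... | yes refl = ℚP.≤-reflexive (≃-sym yv≃0)
    ... | no w≢v   = proj₁ (elsewhere w w≢v)

  drop-weightless : ∀ {x u} → NonNeg x → SmallerSupportsBounded x → u ∈ support x → t u ≃ 0ℚᵘ → Bounded x
  drop-weightless {x} {u} 0≤x below u∈ tu≃0 =
    perturbed-bound⇒bound t {μ = - x u} x (δ u) (ℚP.positive⁻¹ 1ℚᵘ)
      (≃-trans (sum-δ u t) tu≃0) (≃-trans (form-δδ u u) (A-irrefl u))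
      (ℚP.≤-reflexive (≃-sym (≃-trans (*-congˡ { - x u} (≃-trans (form-δʳ x u) Ax≃0)) (*-zeroʳ (- x u)))))
      (uncurry below (clearing-shrinks-support u∈ yu≃0 elsewhere))
    where
    y = 1ℚᵘ ·ᵛ x +ᵛ (- x u) ·ᵛ δ u
    Ax≃0 : (M⋅ x) u ≃ 0ℚᵘ
    Ax≃0 = ≃-trans (sum-cong-≋ (λ w → ≃-trans (*-congʳ {x w} (A-value (weightless⇒isolated tu≃0 w))) (*-zeroˡ (x w))))
                   (sum-replicate-zero n)
    y-at : ∀ w {d} → δ u w ≡ d → y w ≃ 1ℚᵘ · x w + (- x u) · d
    y-at w refl = ≃-refl
    yu≃0 : y u ≃ 0ℚᵘ
    yu≃0 = ≃-trans (y-at u (δ-diag u)) (solve 1 (λ p → con 1ℚᵘ :* p :+ (:- p) :* con 1ℚᵘ := con 0ℚᵘ) ≃-refl (x u))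
    elsewhere : ∀ w → w ≢ u → 0ℚᵘ ≤ y w × (x w ≃ 0ℚᵘ → y w ≃ 0ℚᵘ)
    elsewhere w w≢u = ℚP.≤-respʳ-≃ (≃-sym yw≃xw) (0≤x w) , ≃-trans yw≃xw
      where
      yw≃xw : y w ≃ x w
      yw≃xw = ≃-trans (y-at w (δ-off (≢-sym w≢u)))
                      (solve 2 (λ p q → con 1ℚᵘ :* p :+ (:- q) :* con 0ℚᵘ := p) ≃-refl (x w) (x u))

  shift-weight : ∀ {x u v} → NonNeg x → SmallerSupportsBounded x → u ∈ support x → v ∈ support x →
                 u ≢ v → Adj G u v ≡ false → 0ℚᵘ < t u → t u · (M⋅ x) v ≤ t v · (M⋅ x) u → Bounded x
  shift-weight {x} {u} {v} 0≤x below u∈ v∈ u≢v uv 0<tu oriented =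
    perturbed-bound⇒bound t {μ = x v} x d 0<tu dt≃0
      (form-pair-isotropic (t v) (- t u) (A-irrefl u) (A-value uv) (A-irrefl v))
      (nonNeg-· (0≤x v) (ℚP.≤-respʳ-≃ (≃-sym form-x-d) (ℚP.p≤q⇒0≤q-p oriented)))
      (uncurry below (clearing-shrinks-support v∈ yv≃0 elsewhere))
    where
    d = t v ·ᵛ δ u +ᵛ (- t u) ·ᵛ δ v
    y = t u ·ᵛ x +ᵛ x v ·ᵛ d
    dt≃0 : dot d t ≃ 0ℚᵘ
    dt≃0 = ≃-trans (dot-linearˡ (t v) (δ u) (- t u) (δ v) t)
             (≃-trans (+-cong (*-congˡ {t v} (sum-δ u t)) (*-congˡ { - t u} (sum-δ v t)))
               (solve 2 (λ a b → b :* a :+ (:- a) :* b := con 0ℚᵘ) ≃-refl (t u) (t v)))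
    form-x-d : form x d ≃ t v · (M⋅ x) u - t u · (M⋅ x) v
    form-x-d = ≃-trans (form-linearʳ x (t v) (δ u) (- t u) (δ v))
                 (≃-trans (+-cong (*-congˡ {t v} (form-δʳ x u)) (*-congˡ { - t u} (form-δʳ x v)))
                   (solve 4 (λ a b P Q → b :* P :+ (:- a) :* Q := b :* P :- a :* Q)
                          ≃-refl (t u) (t v) ((M⋅ x) u) ((M⋅ x) v)))
    y-at : ∀ w {a b} → δ u w ≡ a → δ v w ≡ b → y w ≃ t u · x w + x v · (t v · a + (- t u) · b)
    y-at w refl refl = ≃-refl
    yv≃0 : y v ≃ 0ℚᵘ
    yv≃0 = ≃-trans (y-at v (δ-off u≢v) (δ-diag v))
             (solve 3 (λ a p b → a :* p :+ p :* (b :* con 0ℚᵘ :+ (:- a) :* con 1ℚᵘ) := con 0ℚᵘ) ≃-refl (t u) (x v) (t v))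
    elsewhere : ∀ w → w ≢ v → 0ℚᵘ ≤ y w × (x w ≃ 0ℚᵘ → y w ≃ 0ℚᵘ)
    elsewhere w w≢v with w ≟ u
    ... | yes refl = ℚP.≤-respʳ-≃ (≃-sym yu) (nonNeg-+ (nonNeg-· (ℚP.<⇒≤ 0<tu) (0≤x u)) (nonNeg-· (0≤x v) (0≤t v))) ,
                     λ xu≃0 → contradiction xu≃0 (∈-support⁻ x u∈)
      where
      yu : y u ≃ t u · x u + x v · t v
      yu = ≃-trans (y-at u (δ-diag u) (δ-off (≢-sym u≢v)))
             (solve 4 (λ a p q b → a :* p :+ q :* (b :* con 1ℚᵘ :+ (:- a) :* con 0ℚᵘ) := a :* p :+ q :* b)
                    ≃-refl (t u) (x u) (x v) (t v))
    ... | no w≢u = ℚP.≤-respʳ-≃ (≃-sym yw) (nonNeg-· (ℚP.<⇒≤ 0<tu) (0≤x w)) ,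
                   λ xw≃0 → ≃-trans yw (≃-trans (*-congˡ {t u} xw≃0) (*-zeroʳ (t u)))
      where
      yw : y w ≃ t u · x w
      yw = ≃-trans (y-at w (δ-off (≢-sym w≢u)) (δ-off (≢-sym w≢v)))
             (solve 4 (λ a p q b → a :* p :+ q :* (b :* con 0ℚᵘ :+ (:- a) :* con 0ℚᵘ) := a :* p)
                    ≃-refl (t u) (x w) (x v) (t v))

  bounded-step : ∀ {x} → NonNeg x → SmallerSupportsBounded x → Bounded x
  bounded-step {x} 0≤x below with clique-or-nonadjacent (support x)
  ... | inj₁ clique = clique-bounded clique 0≤x
  ... | inj₂ (u , v , u∈ , v∈ , u≢v , uv) with t u ≃? 0ℚᵘ | t v ≃? 0ℚᵘ
  ...   | yes tu≃0 | _        = drop-weightless 0≤x below u∈ tu≃0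
  ...   | no _     | yes tv≃0 = drop-weightless 0≤x below v∈ tv≃0
  ...   | no tu≄0  | no tv≄0 with ℚP.≤-total (t u · (M⋅ x) v) (t v · (M⋅ x) u)
  ...     | inj₁ oriented = shift-weight 0≤x below u∈ v∈ u≢v uv (nonNeg∧≄0⇒pos (0≤t u) tu≄0) oriented
  ...     | inj₂ oriented = shift-weight 0≤x below v∈ u∈ (≢-sym u≢v) (≡.trans (sym G v u) uv)
                              (nonNeg∧≄0⇒pos (0≤t v) tv≄0) oriented

  nonNeg⇒bounded : ∀ x → NonNeg x → Bounded x
  nonNeg⇒bounded = All.wfRec (On.wellFounded (λ x → ∣ support x ∣) <-wellFounded) _ (λ x → NonNeg x → Bounded x)
                     (λ x smaller 0≤x → bounded-step 0≤x (λ y⊂x → smaller (p⊂q⇒∣p∣<∣q∣ y⊂x)))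

lemma5p1 : (n : ℕ) (G : SimpleGraph n) → Connected G →
           (c : Fin n → ℕ) → (∀ v → IsMaxCliqueOrderAt G v (c v)) →
           (r : ℕ) → 1 N.≤ r →
           (t : Fin n → ℚᵘ) → (∀ v → 0ℚᵘ ≤ t v) →
           (∀ v → cRatio (c v) ≤ t v Q.* t v) →
           toℚ (totalWalks G (2 * r))
             ≤ sumFinℚ n (λ v → toℚ (walks G r v) Q.* t v)
                 Q.* sumFinℚ n (λ v → toℚ (walks G r v) Q.* t v)
lemma5p1 n G _ c c-max (suc k) _ t 0≤t cRatio≤t² =
  ℚP.≤-respˡ-≃ (≃-sym (totalWalks[2r]≃form k))
    (≡.subst (λ T → form (W k) (W k) ≤ T · T) (≡.sym (sumFinℚ≡sum n (λ v → W k v · t v)))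
      (nonNeg⇒bounded (W k) (λ v → ℚP.nonNegative⁻¹ (W k v))))
  where
  open AdjacencyForm G
  open WeightedMotzkinStraus G c c-max t 0≤t cRatio≤t²
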